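{- Let $p:L\to R$ be a production between typed simple digraphs, represented after completion on a common node index set $\{1,\dots,n\}$ by Boolean edge matrices $L^E,R^E$ and node vectors $L^V,R^V$, with $e^E=L^E\wedge\overline{R^E}$, $r^E=R^E\wedge\overline{L^E}$, $e^V=L^V\wedge\overline{R^V}$, $r^V=R^V\wedge\overline{L^V}$. Assume $p$ is compatible, i.e. $R=(R^E,R^V)$ has no dangling edges: whenever $R^E_{ij}=1$ then $R^V_i=R^V_j=1$. Let $D$ be the matrix with $D_{ij}=\overline{e^V_i}\wedge\overline{e^V_j}$, and let $N^E=r^E\vee(\overline{e^E}\wedge\overline{D})$ be the nihilation matrix of $p$. Let $p^{ -1}$ be the inverse production (obtained by swapping the roles of $e$ and $r$), acting on a Boolean matrix $X$ by $p^{ -1}(X)=e^E\vee(\overline{r^E}\wedge X)$. Then the matrix of edges that must not be present after applying $p$, namely the edges deleted by $p$ together with the potential dangling edges, $e^E\vee\overline{D}$, satisfies $$p^{ -1}(N^E)=e^E\vee\overline{D}.$$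
   Context: Typed simple digraphs are represented by a Boolean adjacency matrix (at most one edge in each direction between two nodes) and a Boolean vector of existing nodes. Completion means the matrices of $L$ and $R$ are padded with zero rows/columns and reordered so that the elements identified by $p$ occupy the same indices. Overlines denote entrywise Boolean negation; $\wedge,\vee$ are entrywise. $\overline{D}_{ij}=1$ iff node $i$ or node $j$ is deleted by $p$. -}

module Defs where

open import Data.Bool using (Bool; true; false; _∧_; _∨_; not)
open import Data.Nat using (ℕ)
open import Data.Fin using (Fin)
open import Relation.Binary.PropositionalEquality using (_≡_)
open import Data.Product using (_×_)

-- Boolean n×n matrices and Boolean n-vectors on the common (completed) index set
BMat : ℕ → Set
BMat n = Fin n → Fin n → Bool

BVec : ℕ → Set
BVec n = Fin n → Bool

_∧ᴹ_ : ∀ {n} → BMat n → BMat n → BMat n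
(A ∧ᴹ B) i j = A i j ∧ B i j

_∨ᴹ_ : ∀ {n} → BMat n → BMat n → BMat n
(A ∨ᴹ B) i j = A i j ∨ B i j

negᴹ : ∀ {n} → BMat n → BMat n
negᴹ A i j = not (A i j)

_∧ⱽ_ : ∀ {n} → BVec n → BVec n → BVec n
(u ∧ⱽ v) i = u i ∧ v i

negⱽ : ∀ {n} → BVec n → BVec n
negⱽ u i = not (u i)

_≐_ : ∀ {n} → BMat n → BMat n → Set
A ≐ B = ∀ i j → A i j ≡ B i j

module _ {n : ℕ} (LE RE : BMat n) (LV RV : BVec n) where
  eE : BMat n
  eE = LE ∧ᴹ negᴹ RE
  rE : BMat n
  rE = RE ∧ᴹ negᴹ LE
  eV : BVec n
  eV = LV ∧ⱽ negⱽ RV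
  rV : BVec n
  rV = RV ∧ⱽ negⱽ LV
  Dmat : BMat n
  Dmat i j = not (eV i) ∧ not (eV j)
  nihilation : BMat n
  nihilation = rE ∨ᴹ (negᴹ eE ∧ᴹ negᴹ Dmat)
  invProd : BMat n → BMat n
  invProd X = eE ∨ᴹ (negᴹ rE ∧ᴹ X)

Compatible : ∀ {n} → BMat n → BVec n → Set
Compatible RE RV = ∀ i j → RE i j ≡ true → (RV i ≡ true) × (RV j ≡ true)

-- The identity is checked entry by entry, and at each entry (i, j) it is a
-- calculation in the Boolean algebra of truth values.  Write e, r for the
-- deleted and added edge at (i, j) and d = ¬D_ij for "(i, j) may dangle".
-- Then N = r ∨ (¬e ∧ d), and two complement-absorption laws give
--
--   p⁻¹(N) = e ∨ (¬r ∧ (r ∨ (¬e ∧ d))) = e ∨ (¬r ∧ ¬e ∧ d) = e ∨ (¬r ∧ d),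
--
-- an identity valid for every production.  Compatibility enters only once:
-- an added edge has both endpoints in R, so neither endpoint is deleted and
-- the edge cannot be a potential dangling edge (r implies D).  Hence
-- ¬r ∧ d = d and p⁻¹(N) = e ∨ d.
module Submission where

open import Defs
open import Data.Nat using (ℕ)
open import Data.Bool using (Bool; true; false; _∧_; _∨_; not)
open import Data.Bool.Properties
  using (∧-distribˡ-∨; ∨-distribˡ-∧; ∧-inverseˡ; ∨-inverseʳ; ∧-identityˡ; ∨-identityˡ; ∧-assoc; ∧-comm; ∧-zeroʳ)
open import Data.Product using (proj₁; proj₂)
open import Relation.Binary.PropositionalEquality using (_≡_; refl; sym; cong; cong₂; module ≡-Reasoning)
open ≡-Reasoning

not-∧-absorb : (x y : Bool) → not x ∧ (x ∨ y) ≡ not x ∧ y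
not-∧-absorb x y = begin
  not x ∧ (x ∨ y)                ≡⟨ ∧-distribˡ-∨ (not x) x y ⟩
  (not x ∧ x) ∨ (not x ∧ y)      ≡⟨ cong (_∨ (not x ∧ y)) (∧-inverseˡ x) ⟩
  false ∨ (not x ∧ y)            ≡⟨ ∨-identityˡ (not x ∧ y) ⟩
  not x ∧ y                      ∎

∨-not-absorb : (x y : Bool) → x ∨ (not x ∧ y) ≡ x ∨ y
∨-not-absorb x y = begin
  x ∨ (not x ∧ y)                ≡⟨ ∨-distribˡ-∧ x (not x) y ⟩
  (x ∨ not x) ∧ (x ∨ y)          ≡⟨ cong (_∧ (x ∨ y)) (∨-inverseʳ x) ⟩
  true ∧ (x ∨ y)                 ≡⟨ ∧-identityˡ (x ∨ y) ⟩
  x ∨ y                          ∎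

∧-swap : (a b c : Bool) → a ∧ (b ∧ c) ≡ b ∧ (a ∧ c)
∧-swap a b c = begin
  a ∧ (b ∧ c)      ≡⟨ sym (∧-assoc a b c) ⟩
  (a ∧ b) ∧ c      ≡⟨ cong (_∧ c) (∧-comm a b) ⟩
  (b ∧ a) ∧ c      ≡⟨ ∧-assoc b a c ⟩
  b ∧ (a ∧ c)      ∎

not-∧-contrapositive : (x y : Bool) → (x ≡ true → y ≡ true) → not x ∧ not y ≡ not y
not-∧-contrapositive false y x⇒y = refl
not-∧-contrapositive true  y x⇒y rewrite x⇒y refl = refl

module _ {n : ℕ} (LE RE : BMat n) (LV RV : BVec n) where

  invProd-nihilation : invProd LE RE LV RV (nihilation LE RE LV RV)
    ≐ (eE LE RE LV RV ∨ᴹ (negᴹ (rE LE RE LV RV) ∧ᴹ negᴹ (Dmat LE RE LV RV)))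
  invProd-nihilation i j = begin
    e ∨ (not r ∧ (r ∨ (not e ∧ d)))   ≡⟨ cong (e ∨_) (not-∧-absorb r (not e ∧ d)) ⟩
    e ∨ (not r ∧ (not e ∧ d))         ≡⟨ cong (e ∨_) (∧-swap (not r) (not e) d) ⟩
    e ∨ (not e ∧ (not r ∧ d))         ≡⟨ ∨-not-absorb e (not r ∧ d) ⟩
    e ∨ (not r ∧ d)                   ∎
    where
    e r d : Bool
    e = eE LE RE LV RV i j
    r = rE LE RE LV RV i j
    d = not (Dmat LE RE LV RV i j)

  kept-node-not-deleted : ∀ i → RV i ≡ true → eV LE RE LV RV i ≡ false
  kept-node-not-deleted i kept rewrite kept = ∧-zeroʳ (LV i)

  added-edges-do-not-dangle : Compatible RE RV →
    ∀ i j → rE LE RE LV RV i j ≡ true → Dmat LE RE LV RV i j ≡ true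
  added-edges-do-not-dangle compatible i j added with RE i j in inR
  ... | true = begin
    not (eV LE RE LV RV i) ∧ not (eV LE RE LV RV j)
      ≡⟨ cong₂ (λ a b → not a ∧ not b) (kept-node-not-deleted i RVi) (kept-node-not-deleted j RVj) ⟩
    true ∎
    where
    RVi : RV i ≡ true
    RVi = proj₁ (compatible i j inR)
    RVj : RV j ≡ true
    RVj = proj₂ (compatible i j inR)
  added-edges-do-not-dangle compatible i j () | false

mainTheorem2 : (n : ℕ) (LE RE : BMat n) (LV RV : BVec n) →
    Compatible RE RV →
    invProd LE RE LV RV (nihilation LE RE LV RV)
      ≐ (eE LE RE LV RV ∨ᴹ negᴹ (Dmat LE RE LV RV))
mainTheorem2 n LE RE LV RV compatible i j = begin
  invProd LE RE LV RV (nihilation LE RE LV RV) i j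
    ≡⟨ invProd-nihilation LE RE LV RV i j ⟩
  e ∨ (not r ∧ not D)
    ≡⟨ cong (e ∨_) (not-∧-contrapositive r D (added-edges-do-not-dangle LE RE LV RV compatible i j)) ⟩
  e ∨ not D ∎
  where
  e r D : Bool
  e = eE LE RE LV RV i j
  r = rE LE RE LV RV i j
  D = Dmat LE RE LV RV i j
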